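{- Let $a, b$ be positive integers and let $W(x) \in \mathbb{Q}[x]$ have at least two nonzero terms, all of whose exponents are divisible by $4$. If $W(x) \mid Q_{a,b}(x)$ or $W(x) \mid R_{a,b}(x)$, then $2 \mid a$ and $2 \mid b$.
   Context: For positive integers $a,b$: $Q_{a,b}(x) = x^{2a+b} + x^{a+2b} + x^a + x^b - x^{2a+2b} - x^{2a} - x^{2b} - 1$ and $R_{a,b}(x) = x^{2a+b} + x^{a+2b} + x^a + x^b + x^{2a+2b} + x^{2a} + x^{2b} + 1$. -}

module Defs where

open import Data.Nat using (ℕ; zero; suc; _+_; _*_)
open import Data.Nat.Divisibility using (_∣_)
open import Data.Rational using (ℚ; 0ℚ; 1ℚ; -_) renaming (_+_ to _+ℚ_; _*_ to _*ℚ_)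
open import Data.List using (List; []; _∷_; map; replicate; _++_; foldr)
open import Data.Product using (Σ; ∃; _×_; _,_)
open import Relation.Binary.PropositionalEquality using (_≡_; _≢_)

-- A polynomial in ℚ[x] is represented by its list of coefficients
-- [c₀, c₁, c₂, …] (coefficient of xⁱ at position i); trailing zeros are
-- allowed, so polynomials are compared coefficientwise via `coeff`.
Poly : Set
Poly = List ℚ

coeff : Poly → ℕ → ℚ
coeff []       _       = 0ℚ
coeff (c ∷ _)  zero    = c
coeff (_ ∷ cs) (suc n) = coeff cs n

_+ₚ_ : Poly → Poly → Poly
[]       +ₚ q        = q
(p ∷ ps) +ₚ []       = p ∷ ps
(p ∷ ps) +ₚ (q ∷ qs) = (p +ℚ q) ∷ (ps +ₚ qs)

_·ₚ_ : ℚ → Poly → Poly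
c ·ₚ p = map (c *ℚ_) p

_*ₚ_ : Poly → Poly → Poly
[]       *ₚ q = []
(p ∷ ps) *ₚ q = (p ·ₚ q) +ₚ (0ℚ ∷ (ps *ₚ q))

_≈ₚ_ : Poly → Poly → Set
p ≈ₚ q = ∀ n → coeff p n ≡ coeff q n

_∣ₚ_ : Poly → Poly → Set
w ∣ₚ p = Σ Poly (λ c → (w *ₚ c) ≈ₚ p)

mono : ℚ → ℕ → Poly
mono c n = replicate n 0ℚ ++ (c ∷ [])

-1ℚ : ℚ
-1ℚ = - 1ℚ

sumₚ : List Poly → Poly
sumₚ = foldr _+ₚ_ []

Qab : ℕ → ℕ → Poly
Qab a b = sumₚ ( mono 1ℚ (2 * a + b) ∷ mono 1ℚ (a + 2 * b) ∷ mono 1ℚ a ∷ mono 1ℚ b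
               ∷ mono -1ℚ (2 * a + 2 * b) ∷ mono -1ℚ (2 * a) ∷ mono -1ℚ (2 * b) ∷ mono -1ℚ 0 ∷ [])

Rab : ℕ → ℕ → Poly
Rab a b = sumₚ ( mono 1ℚ (2 * a + b) ∷ mono 1ℚ (a + 2 * b) ∷ mono 1ℚ a ∷ mono 1ℚ b
               ∷ mono 1ℚ (2 * a + 2 * b) ∷ mono 1ℚ (2 * a) ∷ mono 1ℚ (2 * b) ∷ mono 1ℚ 0 ∷ [])

AtLeastTwoTerms : Poly → Set
AtLeastTwoTerms w = Σ ℕ (λ i → Σ ℕ (λ j → (i ≢ j) × (coeff w i ≢ 0ℚ) × (coeff w j ≢ 0ℚ)))

ExponentsDivBy4 : Poly → Set
ExponentsDivBy4 w = ∀ n → coeff w n ≢ 0ℚ → 4 ∣ n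

module Submission where

-- Since every exponent of W is a multiple of 4, W divides the part of any multiple of it whose
-- exponents lie in a fixed residue class mod 4: split the cofactor into its residue classes.
-- Write Q_{a,b} and R_{a,b} as P_σ = x^{2a+b} + x^{a+2b} + x^a + x^b + σ(x^{2a+2b} + x^{2a} + x^{2b} + 1)
-- with σ = ∓1. If a is odd, two residue-class parts of P_σ combine, after multiplication by
-- monomials, into a single nonzero term: x^{a+e} with e ∈ {b, 2a+b} if b is even, 2σx^{2b} if
-- b ≡ a, and 2σx^a if b ≡ a + 2 (mod 4). But W cannot divide a single term: a product with a
-- factor of two terms has distinct lowest and highest terms. The case b odd follows by the
-- symmetry P_σ(a, b) = P_σ(b, a).

open import Defs
open import Data.Bool using (Bool; true; false; if_then_else_)
open import Data.Empty using (⊥-elim)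
open import Data.List using (List; []; _∷_; _++_; map; zip)
open import Data.List.Properties using (map-id)
open import Data.List.Relation.Binary.Pointwise using (Pointwise; Pointwise-≡⇒≡; map⁺; _∷_; [])
open import Data.Maybe using (just; nothing)
open import Data.Nat using (ℕ; zero; suc; _+_; _*_; _%_; _≡ᵇ_; _<_; _≤_; _≥_; s≤s; z≤n; NonZero)
open import Data.Nat.Divisibility using (_∣_; divides; ∣n∣m%n⇒∣m)
open import Data.Nat.DivMod using (%-distribˡ-+; %-distribˡ-*; %-remove-+ˡ; m%n%n≡m%n; m%n<n)
import Data.Nat.Properties as ℕ
import Data.Nat.Tactic.RingSolver as ℕ-Ring
open import Data.Product using (Σ; _×_; _,_; proj₂; map₁; map₂)
open import Data.Rational using (ℚ; 0ℚ; 1ℚ; -_; 1/_; ≢-nonZero) renaming (_+_ to _+ℚ_; _*_ to _*ℚ_)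
import Data.Rational.Properties as ℚ
open import Data.Sum using (_⊎_; inj₁; inj₂)
open import Function using (_∘_)
open import Relation.Binary.Definitions using (tri<; tri≈; tri>)
open import Relation.Binary.PropositionalEquality
open import Relation.Nullary using (¬_; yes; no)
open import Tactic.RingSolver using (solve-∀)
open import Tactic.RingSolver.Core.AlmostCommutativeRing using (AlmostCommutativeRing; fromCommutativeRing)

ℚ-ring : AlmostCommutativeRing _ _
ℚ-ring = fromCommutativeRing ℚ.+-*-commutativeRing zero?
  where
  zero? : ∀ x → _
  zero? x with 0ℚ ℚ.≟ x
  ... | yes 0≡x = just 0≡x
  ... | no  _   = nothing

coeff-+ₚ : ∀ p q n → coeff (p +ₚ q) n ≡ coeff p n +ℚ coeff q n
coeff-+ₚ []       q        n       = sym (ℚ.+-identityˡ _)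
coeff-+ₚ (p ∷ ps) []       n       = sym (ℚ.+-identityʳ _)
coeff-+ₚ (p ∷ ps) (q ∷ qs) zero    = refl
coeff-+ₚ (p ∷ ps) (q ∷ qs) (suc n) = coeff-+ₚ ps qs n

coeff-·ₚ : ∀ c p n → coeff (c ·ₚ p) n ≡ c *ℚ coeff p n
coeff-·ₚ c []       n       = sym (ℚ.*-zeroʳ c)
coeff-·ₚ c (x ∷ xs) zero    = refl
coeff-·ₚ c (x ∷ xs) (suc n) = coeff-·ₚ c xs n

+ₚ-identityʳ : ∀ p → p +ₚ [] ≡ p
+ₚ-identityʳ []      = refl
+ₚ-identityʳ (_ ∷ _) = refl

coeff-*ₚ-zero : ∀ w ws q → coeff ((w ∷ ws) *ₚ q) 0 ≡ w *ℚ coeff q 0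
coeff-*ₚ-zero w ws q = begin
  coeff ((w ·ₚ q) +ₚ (0ℚ ∷ (ws *ₚ q))) 0  ≡⟨ coeff-+ₚ (w ·ₚ q) _ 0 ⟩
  coeff (w ·ₚ q) 0 +ℚ 0ℚ                  ≡⟨ ℚ.+-identityʳ _ ⟩
  coeff (w ·ₚ q) 0                        ≡⟨ coeff-·ₚ w q 0 ⟩
  w *ℚ coeff q 0                          ∎
  where open ≡-Reasoning

coeff-*ₚ-suc : ∀ w ws q n → coeff ((w ∷ ws) *ₚ q) (suc n) ≡ w *ℚ coeff q (suc n) +ℚ coeff (ws *ₚ q) n
coeff-*ₚ-suc w ws q n =
  trans (coeff-+ₚ (w ·ₚ q) _ (suc n)) (cong (_+ℚ coeff (ws *ₚ q) n) (coeff-·ₚ w q (suc n)))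

*ₚ-distribˡ-+ₚ : ∀ w c d → (w *ₚ (c +ₚ d)) ≈ₚ ((w *ₚ c) +ₚ (w *ₚ d))
*ₚ-distribˡ-+ₚ []       c d n       = refl
*ₚ-distribˡ-+ₚ (w ∷ ws) c d zero    = begin
  coeff ((w ∷ ws) *ₚ (c +ₚ d)) 0                      ≡⟨ coeff-*ₚ-zero w ws (c +ₚ d) ⟩
  w *ℚ coeff (c +ₚ d) 0                               ≡⟨ cong (w *ℚ_) (coeff-+ₚ c d 0) ⟩
  w *ℚ (coeff c 0 +ℚ coeff d 0)                       ≡⟨ ℚ.*-distribˡ-+ w _ _ ⟩
  w *ℚ coeff c 0 +ℚ w *ℚ coeff d 0                    ≡⟨ cong₂ _+ℚ_ (coeff-*ₚ-zero w ws c) (coeff-*ₚ-zero w ws d) ⟨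
  coeff ((w ∷ ws) *ₚ c) 0 +ℚ coeff ((w ∷ ws) *ₚ d) 0  ≡⟨ coeff-+ₚ ((w ∷ ws) *ₚ c) _ 0 ⟨
  coeff (((w ∷ ws) *ₚ c) +ₚ ((w ∷ ws) *ₚ d)) 0        ∎
  where open ≡-Reasoning
*ₚ-distribˡ-+ₚ (w ∷ ws) c d (suc n) = begin
  coeff ((w ∷ ws) *ₚ (c +ₚ d)) (suc n)
    ≡⟨ coeff-*ₚ-suc w ws (c +ₚ d) n ⟩
  w *ℚ coeff (c +ₚ d) (suc n) +ℚ coeff (ws *ₚ (c +ₚ d)) n
    ≡⟨ cong₂ (λ u v → w *ℚ u +ℚ v) (coeff-+ₚ c d (suc n))
             (trans (*ₚ-distribˡ-+ₚ ws c d n) (coeff-+ₚ (ws *ₚ c) _ n)) ⟩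
  w *ℚ (coeff c (suc n) +ℚ coeff d (suc n)) +ℚ (coeff (ws *ₚ c) n +ℚ coeff (ws *ₚ d) n)
    ≡⟨ interchange w _ _ _ _ ⟩
  (w *ℚ coeff c (suc n) +ℚ coeff (ws *ₚ c) n) +ℚ (w *ℚ coeff d (suc n) +ℚ coeff (ws *ₚ d) n)
    ≡⟨ cong₂ _+ℚ_ (coeff-*ₚ-suc w ws c n) (coeff-*ₚ-suc w ws d n) ⟨
  coeff ((w ∷ ws) *ₚ c) (suc n) +ℚ coeff ((w ∷ ws) *ₚ d) (suc n)
    ≡⟨ coeff-+ₚ ((w ∷ ws) *ₚ c) _ (suc n) ⟨
  coeff (((w ∷ ws) *ₚ c) +ₚ ((w ∷ ws) *ₚ d)) (suc n) ∎
  where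
  open ≡-Reasoning
  interchange : ∀ w c d x y → w *ℚ (c +ℚ d) +ℚ (x +ℚ y) ≡ (w *ℚ c +ℚ x) +ℚ (w *ℚ d +ℚ y)
  interchange = solve-∀ ℚ-ring

*ₚ-·ₚ-comm : ∀ w c q → (w *ₚ (c ·ₚ q)) ≈ₚ (c ·ₚ (w *ₚ q))
*ₚ-·ₚ-comm []       c q n       = refl
*ₚ-·ₚ-comm (w ∷ ws) c q zero    = begin
  coeff ((w ∷ ws) *ₚ (c ·ₚ q)) 0  ≡⟨ coeff-*ₚ-zero w ws (c ·ₚ q) ⟩
  w *ℚ coeff (c ·ₚ q) 0           ≡⟨ cong (w *ℚ_) (coeff-·ₚ c q 0) ⟩
  w *ℚ (c *ℚ coeff q 0)           ≡⟨ swap w c _ ⟩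
  c *ℚ (w *ℚ coeff q 0)           ≡⟨ cong (c *ℚ_) (coeff-*ₚ-zero w ws q) ⟨
  c *ℚ coeff ((w ∷ ws) *ₚ q) 0    ≡⟨ coeff-·ₚ c ((w ∷ ws) *ₚ q) 0 ⟨
  coeff (c ·ₚ ((w ∷ ws) *ₚ q)) 0  ∎
  where
  open ≡-Reasoning
  swap : ∀ w c x → w *ℚ (c *ℚ x) ≡ c *ℚ (w *ℚ x)
  swap = solve-∀ ℚ-ring
*ₚ-·ₚ-comm (w ∷ ws) c q (suc n) = begin
  coeff ((w ∷ ws) *ₚ (c ·ₚ q)) (suc n)
    ≡⟨ coeff-*ₚ-suc w ws (c ·ₚ q) n ⟩
  w *ℚ coeff (c ·ₚ q) (suc n) +ℚ coeff (ws *ₚ (c ·ₚ q)) n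
    ≡⟨ cong₂ (λ u v → w *ℚ u +ℚ v) (coeff-·ₚ c q (suc n))
             (trans (*ₚ-·ₚ-comm ws c q n) (coeff-·ₚ c (ws *ₚ q) n)) ⟩
  w *ℚ (c *ℚ coeff q (suc n)) +ℚ c *ℚ coeff (ws *ₚ q) n
    ≡⟨ factor w c _ _ ⟩
  c *ℚ (w *ℚ coeff q (suc n) +ℚ coeff (ws *ₚ q) n)
    ≡⟨ cong (c *ℚ_) (coeff-*ₚ-suc w ws q n) ⟨
  c *ℚ coeff ((w ∷ ws) *ₚ q) (suc n)
    ≡⟨ coeff-·ₚ c ((w ∷ ws) *ₚ q) (suc n) ⟨
  coeff (c ·ₚ ((w ∷ ws) *ₚ q)) (suc n) ∎
  where
  open ≡-Reasoning
  factor : ∀ w c x y → w *ℚ (c *ℚ x) +ℚ c *ℚ y ≡ c *ℚ (w *ℚ x +ℚ y)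
  factor = solve-∀ ℚ-ring

*ₚ-∷0 : ∀ w q → (w *ₚ (0ℚ ∷ q)) ≈ₚ (0ℚ ∷ (w *ₚ q))
*ₚ-∷0 []       q zero          = refl
*ₚ-∷0 []       q (suc n)       = refl
*ₚ-∷0 (w ∷ ws) q zero          = trans (coeff-*ₚ-zero w ws (0ℚ ∷ q)) (ℚ.*-zeroʳ w)
*ₚ-∷0 (w ∷ ws) q (suc zero)    = begin
  coeff ((w ∷ ws) *ₚ (0ℚ ∷ q)) 1              ≡⟨ coeff-*ₚ-suc w ws (0ℚ ∷ q) 0 ⟩
  w *ℚ coeff q 0 +ℚ coeff (ws *ₚ (0ℚ ∷ q)) 0  ≡⟨ cong (w *ℚ coeff q 0 +ℚ_) (*ₚ-∷0 ws q 0) ⟩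
  w *ℚ coeff q 0 +ℚ 0ℚ                        ≡⟨ ℚ.+-identityʳ _ ⟩
  w *ℚ coeff q 0                              ≡⟨ coeff-*ₚ-zero w ws q ⟨
  coeff ((w ∷ ws) *ₚ q) 0                     ∎
  where open ≡-Reasoning
*ₚ-∷0 (w ∷ ws) q (suc (suc n)) = begin
  coeff ((w ∷ ws) *ₚ (0ℚ ∷ q)) (suc (suc n))
    ≡⟨ coeff-*ₚ-suc w ws (0ℚ ∷ q) (suc n) ⟩
  w *ℚ coeff q (suc n) +ℚ coeff (ws *ₚ (0ℚ ∷ q)) (suc n)
    ≡⟨ cong (w *ℚ coeff q (suc n) +ℚ_) (*ₚ-∷0 ws q (suc n)) ⟩
  w *ℚ coeff q (suc n) +ℚ coeff (ws *ₚ q) n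
    ≡⟨ coeff-*ₚ-suc w ws q n ⟨
  coeff ((w ∷ ws) *ₚ q) (suc n) ∎
  where open ≡-Reasoning

module _ (w : Poly) where

  ∣ₚ-resp-≈ₚ : ∀ p q → p ≈ₚ q → w ∣ₚ p → w ∣ₚ q
  ∣ₚ-resp-≈ₚ p q p≈q (c , wc≈p) = c , λ n → trans (wc≈p n) (p≈q n)

  ∣ₚ-+ₚ : ∀ p q → w ∣ₚ p → w ∣ₚ q → w ∣ₚ (p +ₚ q)
  ∣ₚ-+ₚ p q (c , wc≈p) (d , wd≈q) = c +ₚ d , λ n → begin
    coeff (w *ₚ (c +ₚ d)) n               ≡⟨ *ₚ-distribˡ-+ₚ w c d n ⟩
    coeff ((w *ₚ c) +ₚ (w *ₚ d)) n        ≡⟨ coeff-+ₚ (w *ₚ c) (w *ₚ d) n ⟩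
    coeff (w *ₚ c) n +ℚ coeff (w *ₚ d) n  ≡⟨ cong₂ _+ℚ_ (wc≈p n) (wd≈q n) ⟩
    coeff p n +ℚ coeff q n                ≡⟨ coeff-+ₚ p q n ⟨
    coeff (p +ₚ q) n                      ∎
    where open ≡-Reasoning

  ∣ₚ-·ₚ : ∀ k p → w ∣ₚ p → w ∣ₚ (k ·ₚ p)
  ∣ₚ-·ₚ k p (c , wc≈p) = k ·ₚ c , λ n → begin
    coeff (w *ₚ (k ·ₚ c)) n  ≡⟨ *ₚ-·ₚ-comm w k c n ⟩
    coeff (k ·ₚ (w *ₚ c)) n  ≡⟨ coeff-·ₚ k (w *ₚ c) n ⟩
    k *ℚ coeff (w *ₚ c) n    ≡⟨ cong (k *ℚ_) (wc≈p n) ⟩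
    k *ℚ coeff p n           ≡⟨ coeff-·ₚ k p n ⟨
    coeff (k ·ₚ p) n         ∎
    where open ≡-Reasoning

  ∣ₚ-∷0 : ∀ p → w ∣ₚ p → w ∣ₚ (0ℚ ∷ p)
  ∣ₚ-∷0 p (c , wc≈p) = 0ℚ ∷ c , λ n → trans (*ₚ-∷0 w c n) (shifted n)
    where
    shifted : ∀ n → coeff (0ℚ ∷ (w *ₚ c)) n ≡ coeff (0ℚ ∷ p) n
    shifted zero    = refl
    shifted (suc n) = wc≈p n

select : Bool → ℚ → ℚ
select b x = if b then x else 0ℚ

select-0ℚ : ∀ b → select b 0ℚ ≡ 0ℚ
select-0ℚ true  = refl
select-0ℚ false = refl

select-+ : ∀ b x y → select b x +ℚ select b y ≡ select b (x +ℚ y)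
select-+ true  x y = refl
select-+ false x y = ℚ.+-identityʳ 0ℚ

*-select : ∀ w b x → w *ℚ select b x ≡ select b (w *ℚ x)
*-select w true  x = refl
*-select w false x = ℚ.*-zeroʳ w

*-select-≢0 : ∀ w b b′ x → (w ≢ 0ℚ → b ≡ b′) → w *ℚ select b′ x ≡ select b (w *ℚ x)
*-select-≢0 w b b′ x h with w ℚ.≟ 0ℚ
... | no  w≢0 rewrite h w≢0 = *-select w b′ x
... | yes refl = begin
  0ℚ *ℚ select b′ x   ≡⟨ ℚ.*-zeroˡ (select b′ x) ⟩
  0ℚ                  ≡⟨ select-0ℚ b ⟨
  select b 0ℚ         ≡⟨ cong (select b) (ℚ.*-zeroˡ x) ⟨
  select b (0ℚ *ℚ x)  ∎
  where open ≡-Reasoning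

restrictₚ : (ℕ → Bool) → Poly → Poly
restrictₚ f []       = []
restrictₚ f (c ∷ cs) = select (f 0) c ∷ restrictₚ (f ∘ suc) cs

coeff-restrictₚ : ∀ f p n → coeff (restrictₚ f p) n ≡ select (f n) (coeff p n)
coeff-restrictₚ f []       n       = sym (select-0ℚ (f n))
coeff-restrictₚ f (c ∷ cs) zero    = refl
coeff-restrictₚ f (c ∷ cs) (suc n) = coeff-restrictₚ (f ∘ suc) cs n

*ₚ-restrictₚ : ∀ w c (f g : ℕ → Bool) → (∀ i → coeff w i ≢ 0ℚ → ∀ j → f (i + j) ≡ g j) →
               (w *ₚ restrictₚ g c) ≈ₚ restrictₚ f (w *ₚ c)
*ₚ-restrictₚ []       c f g h n       = refl
*ₚ-restrictₚ (w ∷ ws) c f g h zero    = begin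
  coeff ((w ∷ ws) *ₚ restrictₚ g c) 0     ≡⟨ coeff-*ₚ-zero w ws (restrictₚ g c) ⟩
  w *ℚ coeff (restrictₚ g c) 0            ≡⟨ cong (w *ℚ_) (coeff-restrictₚ g c 0) ⟩
  w *ℚ select (g 0) (coeff c 0)           ≡⟨ *-select-≢0 w (f 0) (g 0) _ (λ w≢0 → h 0 w≢0 0) ⟩
  select (f 0) (w *ℚ coeff c 0)           ≡⟨ cong (select (f 0)) (coeff-*ₚ-zero w ws c) ⟨
  select (f 0) (coeff ((w ∷ ws) *ₚ c) 0)  ≡⟨ coeff-restrictₚ f ((w ∷ ws) *ₚ c) 0 ⟨
  coeff (restrictₚ f ((w ∷ ws) *ₚ c)) 0   ∎
  where open ≡-Reasoning
*ₚ-restrictₚ (w ∷ ws) c f g h (suc n) = begin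
  coeff ((w ∷ ws) *ₚ restrictₚ g c) (suc n)
    ≡⟨ coeff-*ₚ-suc w ws (restrictₚ g c) n ⟩
  w *ℚ coeff (restrictₚ g c) (suc n) +ℚ coeff (ws *ₚ restrictₚ g c) n
    ≡⟨ cong₂ (λ u v → w *ℚ u +ℚ v) (coeff-restrictₚ g c (suc n))
             (trans (*ₚ-restrictₚ ws c (f ∘ suc) g (h ∘ suc) n) (coeff-restrictₚ (f ∘ suc) (ws *ₚ c) n)) ⟩
  w *ℚ select (g (suc n)) (coeff c (suc n)) +ℚ select (f (suc n)) (coeff (ws *ₚ c) n)
    ≡⟨ cong (_+ℚ select (f (suc n)) (coeff (ws *ₚ c) n))
            (*-select-≢0 w (f (suc n)) (g (suc n)) _ (λ w≢0 → h 0 w≢0 (suc n))) ⟩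
  select (f (suc n)) (w *ℚ coeff c (suc n)) +ℚ select (f (suc n)) (coeff (ws *ₚ c) n)
    ≡⟨ select-+ (f (suc n)) _ _ ⟩
  select (f (suc n)) (w *ℚ coeff c (suc n) +ℚ coeff (ws *ₚ c) n)
    ≡⟨ cong (select (f (suc n))) (coeff-*ₚ-suc w ws c n) ⟨
  select (f (suc n)) (coeff ((w ∷ ws) *ₚ c) (suc n))
    ≡⟨ coeff-restrictₚ f ((w ∷ ws) *ₚ c) (suc n) ⟨
  coeff (restrictₚ f ((w ∷ ws) *ₚ c)) (suc n) ∎
  where open ≡-Reasoning

∣ₚ-restrictₚ : ∀ w p (f : ℕ → Bool) → (∀ i → coeff w i ≢ 0ℚ → ∀ j → f (i + j) ≡ f j) →
               w ∣ₚ p → w ∣ₚ restrictₚ f p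
∣ₚ-restrictₚ w p f inv (c , wc≈p) = restrictₚ f c , λ n → begin
  coeff (w *ₚ restrictₚ f c) n     ≡⟨ *ₚ-restrictₚ w c f f inv n ⟩
  coeff (restrictₚ f (w *ₚ c)) n   ≡⟨ coeff-restrictₚ f (w *ₚ c) n ⟩
  select (f n) (coeff (w *ₚ c) n)  ≡⟨ cong (select (f n)) (wc≈p n) ⟩
  select (f n) (coeff p n)         ≡⟨ coeff-restrictₚ f p n ⟨
  coeff (restrictₚ f p) n          ∎
  where open ≡-Reasoning

IsZero : Poly → Set
IsZero p = ∀ i → coeff p i ≡ 0ℚ

IsLowest IsHighest : Poly → ℕ → Set
IsLowest  p i = coeff p i ≢ 0ℚ × (∀ j → j < i → coeff p j ≡ 0ℚ)
IsHighest p i = coeff p i ≢ 0ℚ × (∀ j → i < j → coeff p j ≡ 0ℚ)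

isZero-or-lowest : ∀ p → IsZero p ⊎ Σ ℕ (IsLowest p)
isZero-or-lowest []       = inj₁ (λ _ → refl)
isZero-or-lowest (c ∷ cs) with c ℚ.≟ 0ℚ | isZero-or-lowest cs
... | no  c≢0 | _                        = inj₂ (0 , c≢0 , λ _ ())
... | yes c≡0 | inj₁ cs≈0                = inj₁ λ { zero → c≡0 ; (suc i) → cs≈0 i }
... | yes c≡0 | inj₂ (i , cᵢ≢0 , below)  =
  inj₂ (suc i , cᵢ≢0 , λ { zero _ → c≡0 ; (suc j) (s≤s j<i) → below j j<i })

isZero-or-highest : ∀ p → IsZero p ⊎ Σ ℕ (IsHighest p)
isZero-or-highest []       = inj₁ (λ _ → refl)
isZero-or-highest (c ∷ cs) with isZero-or-highest cs | c ℚ.≟ 0ℚ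
... | inj₂ (i , cᵢ≢0 , above) | _       = inj₂ (suc i , cᵢ≢0 , λ { zero () ; (suc j) (s≤s i<j) → above j i<j })
... | inj₁ cs≈0               | yes c≡0 = inj₁ λ { zero → c≡0 ; (suc i) → cs≈0 i }
... | inj₁ cs≈0               | no  c≢0 = inj₂ (0 , c≢0 , λ { zero () ; (suc j) _ → cs≈0 j })

lowest-≤ : ∀ p {i j} → IsLowest p i → coeff p j ≢ 0ℚ → i ≤ j
lowest-≤ p (_ , below) pⱼ≢0 = ℕ.≮⇒≥ (λ j<i → pⱼ≢0 (below _ j<i))

highest-≥ : ∀ p {i j} → IsHighest p i → coeff p j ≢ 0ℚ → j ≤ i
highest-≥ p (_ , above) pⱼ≢0 = ℕ.≮⇒≥ (λ i<j → pⱼ≢0 (above _ i<j))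

*ₚ-zero-below : ∀ w c q → (∀ j → j < q → coeff c j ≡ 0ℚ) → ∀ m → m < q → coeff (w *ₚ c) m ≡ 0ℚ
*ₚ-zero-below []       c q c≈0 m       m<q = refl
*ₚ-zero-below (w ∷ ws) c q c≈0 zero    0<q =
  trans (coeff-*ₚ-zero w ws c) (trans (cong (w *ℚ_) (c≈0 0 0<q)) (ℚ.*-zeroʳ w))
*ₚ-zero-below (w ∷ ws) c q c≈0 (suc m) m<q = begin
  coeff ((w ∷ ws) *ₚ c) (suc m)              ≡⟨ coeff-*ₚ-suc w ws c m ⟩
  w *ℚ coeff c (suc m) +ℚ coeff (ws *ₚ c) m  ≡⟨ cong₂ (λ u v → w *ℚ u +ℚ v) (c≈0 (suc m) m<q)
                                                  (*ₚ-zero-below ws c q c≈0 m (ℕ.<-trans (ℕ.n<1+n m) m<q)) ⟩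
  w *ℚ 0ℚ +ℚ 0ℚ                              ≡⟨ cong (_+ℚ 0ℚ) (ℚ.*-zeroʳ w) ⟩
  0ℚ                                         ∎
  where open ≡-Reasoning

*ₚ-zeroˡ : ∀ w c → IsZero w → IsZero (w *ₚ c)
*ₚ-zeroˡ []       c w≈0 m       = refl
*ₚ-zeroˡ (w ∷ ws) c w≈0 zero    =
  trans (coeff-*ₚ-zero w ws c) (trans (cong (_*ℚ coeff c 0) (w≈0 0)) (ℚ.*-zeroˡ (coeff c 0)))
*ₚ-zeroˡ (w ∷ ws) c w≈0 (suc m) = begin
  coeff ((w ∷ ws) *ₚ c) (suc m)              ≡⟨ coeff-*ₚ-suc w ws c m ⟩
  w *ℚ coeff c (suc m) +ℚ coeff (ws *ₚ c) m  ≡⟨ cong₂ (λ u v → u *ℚ coeff c (suc m) +ℚ v) (w≈0 0)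
                                                  (*ₚ-zeroˡ ws c (w≈0 ∘ suc) m) ⟩
  0ℚ *ℚ coeff c (suc m) +ℚ 0ℚ                ≡⟨ cong (_+ℚ 0ℚ) (ℚ.*-zeroˡ (coeff c (suc m))) ⟩
  0ℚ                                         ∎
  where open ≡-Reasoning

coeff-*ₚ-lowest : ∀ w c p q → (∀ i → i < p → coeff w i ≡ 0ℚ) → (∀ j → j < q → coeff c j ≡ 0ℚ) →
                  coeff (w *ₚ c) (p + q) ≡ coeff w p *ℚ coeff c q
coeff-*ₚ-lowest []       c p       q       w≈0 c≈0 = sym (ℚ.*-zeroˡ (coeff c q))
coeff-*ₚ-lowest (w ∷ ws) c zero    zero    w≈0 c≈0 = coeff-*ₚ-zero w ws c
coeff-*ₚ-lowest (w ∷ ws) c zero    (suc q) w≈0 c≈0 = begin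
  coeff ((w ∷ ws) *ₚ c) (suc q)              ≡⟨ coeff-*ₚ-suc w ws c q ⟩
  w *ℚ coeff c (suc q) +ℚ coeff (ws *ₚ c) q  ≡⟨ cong (w *ℚ coeff c (suc q) +ℚ_)
                                                     (*ₚ-zero-below ws c (suc q) c≈0 q (ℕ.n<1+n q)) ⟩
  w *ℚ coeff c (suc q) +ℚ 0ℚ                 ≡⟨ ℚ.+-identityʳ _ ⟩
  w *ℚ coeff c (suc q)                       ∎
  where open ≡-Reasoning
coeff-*ₚ-lowest (w ∷ ws) c (suc p) q       w≈0 c≈0 = begin
  coeff ((w ∷ ws) *ₚ c) (suc (p + q))
    ≡⟨ coeff-*ₚ-suc w ws c (p + q) ⟩
  w *ℚ coeff c (suc (p + q)) +ℚ coeff (ws *ₚ c) (p + q)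
    ≡⟨ cong (λ u → u *ℚ coeff c (suc (p + q)) +ℚ coeff (ws *ₚ c) (p + q)) (w≈0 0 (s≤s z≤n)) ⟩
  0ℚ *ℚ coeff c (suc (p + q)) +ℚ coeff (ws *ₚ c) (p + q)
    ≡⟨ cong (_+ℚ coeff (ws *ₚ c) (p + q)) (ℚ.*-zeroˡ (coeff c (suc (p + q)))) ⟩
  0ℚ +ℚ coeff (ws *ₚ c) (p + q)
    ≡⟨ ℚ.+-identityˡ _ ⟩
  coeff (ws *ₚ c) (p + q)
    ≡⟨ coeff-*ₚ-lowest ws c p q (λ i i<p → w≈0 (suc i) (s≤s i<p)) c≈0 ⟩
  coeff ws p *ℚ coeff c q ∎
  where open ≡-Reasoning

coeff-*ₚ-highest : ∀ w c p q → (∀ i → p < i → coeff w i ≡ 0ℚ) → (∀ j → q < j → coeff c j ≡ 0ℚ) →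
                   coeff (w *ₚ c) (p + q) ≡ coeff w p *ℚ coeff c q
coeff-*ₚ-highest []       c p       q       w≈0 c≈0 = sym (ℚ.*-zeroˡ (coeff c q))
coeff-*ₚ-highest (w ∷ ws) c zero    zero    w≈0 c≈0 = coeff-*ₚ-zero w ws c
coeff-*ₚ-highest (w ∷ ws) c zero    (suc q) w≈0 c≈0 = begin
  coeff ((w ∷ ws) *ₚ c) (suc q)              ≡⟨ coeff-*ₚ-suc w ws c q ⟩
  w *ℚ coeff c (suc q) +ℚ coeff (ws *ₚ c) q  ≡⟨ cong (w *ℚ coeff c (suc q) +ℚ_)
                                                     (*ₚ-zeroˡ ws c (λ i → w≈0 (suc i) (s≤s z≤n)) q) ⟩
  w *ℚ coeff c (suc q) +ℚ 0ℚ                 ≡⟨ ℚ.+-identityʳ _ ⟩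
  w *ℚ coeff c (suc q)                       ∎
  where open ≡-Reasoning
coeff-*ₚ-highest (w ∷ ws) c (suc p) q       w≈0 c≈0 = begin
  coeff ((w ∷ ws) *ₚ c) (suc (p + q))
    ≡⟨ coeff-*ₚ-suc w ws c (p + q) ⟩
  w *ℚ coeff c (suc (p + q)) +ℚ coeff (ws *ₚ c) (p + q)
    ≡⟨ cong (λ u → w *ℚ u +ℚ coeff (ws *ₚ c) (p + q)) (c≈0 _ (s≤s (ℕ.m≤n+m q p))) ⟩
  w *ℚ 0ℚ +ℚ coeff (ws *ₚ c) (p + q)
    ≡⟨ cong (_+ℚ coeff (ws *ₚ c) (p + q)) (ℚ.*-zeroʳ w) ⟩
  0ℚ +ℚ coeff (ws *ₚ c) (p + q)
    ≡⟨ ℚ.+-identityˡ _ ⟩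
  coeff (ws *ₚ c) (p + q)
    ≡⟨ coeff-*ₚ-highest ws c p q (λ i p<i → w≈0 (suc i) (s≤s p<i)) c≈0 ⟩
  coeff ws p *ℚ coeff c q ∎
  where open ≡-Reasoning

*-≢0 : ∀ {x y} → x ≢ 0ℚ → y ≢ 0ℚ → x *ℚ y ≢ 0ℚ
*-≢0 {x} {y} x≢0 y≢0 xy≡0 = y≢0 (begin
  y                   ≡⟨ ℚ.*-identityˡ y ⟨
  1ℚ *ℚ y             ≡⟨ cong (_*ℚ y) (ℚ.*-inverseˡ x) ⟨
  (1/ x) *ℚ x *ℚ y    ≡⟨ ℚ.*-assoc (1/ x) x y ⟩
  (1/ x) *ℚ (x *ℚ y)  ≡⟨ cong ((1/ x) *ℚ_) xy≡0 ⟩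
  (1/ x) *ℚ 0ℚ        ≡⟨ ℚ.*-zeroʳ (1/ x) ⟩
  0ℚ                  ∎)
  where
  open ≡-Reasoning
  instance _ = ≢-nonZero x≢0

*ₚ-two-terms : ∀ w q → AtLeastTwoTerms w → ¬ IsZero q → AtLeastTwoTerms (w *ₚ q)
*ₚ-two-terms w q (i , j , i≢j , wᵢ≢0 , wⱼ≢0) q≉0
  with isZero-or-lowest w | isZero-or-highest w | isZero-or-lowest q | isZero-or-highest q
... | inj₁ w≈0 | _        | _        | _        = ⊥-elim (wᵢ≢0 (w≈0 i))
... | _        | inj₁ w≈0 | _        | _        = ⊥-elim (wᵢ≢0 (w≈0 i))
... | _        | _        | inj₁ q≈0 | _        = ⊥-elim (q≉0 q≈0)
... | _        | _        | _        | inj₁ q≈0 = ⊥-elim (q≉0 q≈0)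
... | inj₂ (i₀ , lowW@(wᵢ₀≢0 , belowW)) | inj₂ (i₁ , highW@(wᵢ₁≢0 , aboveW))
    | inj₂ (j₀ , lowQ@(qⱼ₀≢0 , belowQ)) | inj₂ (j₁ , (qⱼ₁≢0 , aboveQ)) =
  i₀ + j₀ , i₁ + j₁ , ℕ.<⇒≢ (ℕ.+-mono-<-≤ i₀<i₁ (lowest-≤ q lowQ qⱼ₁≢0)) ,
  (λ ≡0 → *-≢0 wᵢ₀≢0 qⱼ₀≢0 (trans (sym (coeff-*ₚ-lowest w q i₀ j₀ belowW belowQ)) ≡0)) ,
  (λ ≡0 → *-≢0 wᵢ₁≢0 qⱼ₁≢0 (trans (sym (coeff-*ₚ-highest w q i₁ j₁ aboveW aboveQ)) ≡0))
  where
  i₀<i₁ : i₀ < i₁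
  i₀<i₁ with ℕ.<-cmp i j
  ... | tri< i<j _ _ = ℕ.≤-<-trans (lowest-≤ w lowW wᵢ≢0) (ℕ.<-≤-trans i<j (highest-≥ w highW wⱼ≢0))
  ... | tri≈ _ i≡j _ = ⊥-elim (i≢j i≡j)
  ... | tri> _ _ j<i = ℕ.≤-<-trans (lowest-≤ w lowW wⱼ≢0) (ℕ.<-≤-trans j<i (highest-≥ w highW wᵢ≢0))

δ : ℕ → ℕ → ℚ
δ e m = if e ≡ᵇ m then 1ℚ else 0ℚ

δ-≢ : ∀ e m → e ≢ m → δ e m ≡ 0ℚ
δ-≢ zero    zero    e≢m = ⊥-elim (e≢m refl)
δ-≢ zero    (suc m) e≢m = refl
δ-≢ (suc e) zero    e≢m = refl
δ-≢ (suc e) (suc m) e≢m = δ-≢ e m (e≢m ∘ cong suc)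

coeff-mono : ∀ c e m → coeff (mono c e) m ≡ c *ℚ δ e m
coeff-mono c zero    zero    = sym (ℚ.*-identityʳ c)
coeff-mono c zero    (suc m) = sym (ℚ.*-zeroʳ c)
coeff-mono c (suc e) zero    = sym (ℚ.*-zeroʳ c)
coeff-mono c (suc e) (suc m) = coeff-mono c e m

coeff-mono-≡ : ∀ c e → coeff (mono c e) e ≡ c
coeff-mono-≡ c zero    = refl
coeff-mono-≡ c (suc e) = coeff-mono-≡ c e

coeff-mono-≢0 : ∀ c e {m} → coeff (mono c e) m ≢ 0ℚ → m ≡ e
coeff-mono-≢0 c e {m} ≢0 with m ℕ.≟ e
... | yes m≡e = m≡e
... | no  m≢e = ⊥-elim (≢0 (begin
  coeff (mono c e) m  ≡⟨ coeff-mono c e m ⟩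
  c *ℚ δ e m          ≡⟨ cong (c *ℚ_) (δ-≢ e m (m≢e ∘ sym)) ⟩
  c *ℚ 0ℚ             ≡⟨ ℚ.*-zeroʳ c ⟩
  0ℚ                  ∎))
  where open ≡-Reasoning

mono-¬two-terms : ∀ c e → ¬ AtLeastTwoTerms (mono c e)
mono-¬two-terms c e (i , j , i≢j , ≢0 , ≢0′) = i≢j (trans (coeff-mono-≢0 c e ≢0) (sym (coeff-mono-≢0 c e ≢0′)))

∤-mono : ∀ w c e → AtLeastTwoTerms w → c ≢ 0ℚ → ¬ (w ∣ₚ mono c e)
∤-mono w c e two c≢0 (q , wq≈mono) = mono-¬two-terms c e (transport (*ₚ-two-terms w q two q≉0))
  where
  q≉0 : ¬ IsZero q
  q≉0 q≈0 = c≢0 (begin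
    c                   ≡⟨ coeff-mono-≡ c e ⟨
    coeff (mono c e) e  ≡⟨ wq≈mono e ⟨
    coeff (w *ₚ q) e    ≡⟨ *ₚ-zero-below w q (suc e) (λ j _ → q≈0 j) e (ℕ.n<1+n e) ⟩
    0ℚ                  ∎)
    where open ≡-Reasoning

  transport : AtLeastTwoTerms (w *ₚ q) → AtLeastTwoTerms (mono c e)
  transport (i , j , i≢j , ≢0 , ≢0′) = i , j , i≢j , subst (_≢ 0ℚ) (wq≈mono i) ≢0 , subst (_≢ 0ℚ) (wq≈mono j) ≢0′

Sparse : Set
Sparse = List (ℚ × ℕ)

⟦_⟧ : Sparse → Poly
⟦ []           ⟧ = []
⟦ (c , e) ∷ ts ⟧ = mono c e +ₚ ⟦ ts ⟧

coeffₛ : Sparse → ℕ → ℚ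
coeffₛ []             m = 0ℚ
coeffₛ ((c , e) ∷ ts) m = c *ℚ δ e m +ℚ coeffₛ ts m

coeff-⟦⟧ : ∀ ts m → coeff ⟦ ts ⟧ m ≡ coeffₛ ts m
coeff-⟦⟧ []             m = refl
coeff-⟦⟧ ((c , e) ∷ ts) m = trans (coeff-+ₚ (mono c e) ⟦ ts ⟧ m) (cong₂ _+ℚ_ (coeff-mono c e m) (coeff-⟦⟧ ts m))

infix 4 _≈ₛ_
_≈ₛ_ : Sparse → Sparse → Set
ts ≈ₛ us = ∀ m → coeffₛ ts m ≡ coeffₛ us m

shiftₛ : ℕ → Sparse → Sparse
shiftₛ k = map (map₂ (k +_))

scaleₛ : ℚ → Sparse → Sparse
scaleₛ k = map (map₁ (k *ℚ_))

mask : {A : Set} → List Bool → List A → List A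
mask []           _        = []
mask (_ ∷ _)      []       = []
mask (true ∷ bs)  (x ∷ xs) = x ∷ mask bs xs
mask (false ∷ bs) (x ∷ xs) = mask bs xs

restrictₛ : (ℕ → Bool) → Sparse → Sparse
restrictₛ f ts = mask (map (f ∘ proj₂) ts) ts

coeffₛ-++ : ∀ ts us m → coeffₛ (ts ++ us) m ≡ coeffₛ ts m +ℚ coeffₛ us m
coeffₛ-++ []             us m = sym (ℚ.+-identityˡ _)
coeffₛ-++ ((c , e) ∷ ts) us m =
  trans (cong (c *ℚ δ e m +ℚ_) (coeffₛ-++ ts us m)) (sym (ℚ.+-assoc (c *ℚ δ e m) (coeffₛ ts m) (coeffₛ us m)))

coeffₛ-scaleₛ : ∀ k ts m → coeffₛ (scaleₛ k ts) m ≡ k *ℚ coeffₛ ts m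
coeffₛ-scaleₛ k []             m = sym (ℚ.*-zeroʳ k)
coeffₛ-scaleₛ k ((c , e) ∷ ts) m =
  trans (cong₂ _+ℚ_ (ℚ.*-assoc k c (δ e m)) (coeffₛ-scaleₛ k ts m)) (sym (ℚ.*-distribˡ-+ k _ _))

coeffₛ-shiftₛ-zero : ∀ k ts → coeffₛ (shiftₛ (suc k) ts) 0 ≡ 0ℚ
coeffₛ-shiftₛ-zero k []             = refl
coeffₛ-shiftₛ-zero k ((c , e) ∷ ts) =
  trans (cong₂ _+ℚ_ (ℚ.*-zeroʳ c) (coeffₛ-shiftₛ-zero k ts)) (ℚ.+-identityʳ 0ℚ)

coeffₛ-shiftₛ-suc : ∀ k ts m → coeffₛ (shiftₛ (suc k) ts) (suc m) ≡ coeffₛ (shiftₛ k ts) m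
coeffₛ-shiftₛ-suc k []             m = refl
coeffₛ-shiftₛ-suc k ((c , e) ∷ ts) m = cong (c *ℚ δ (k + e) m +ℚ_) (coeffₛ-shiftₛ-suc k ts m)

select-δ : ∀ (f : ℕ → Bool) c e m → select (f m) (c *ℚ δ e m) ≡ select (f e) (c *ℚ δ e m)
select-δ f c e m with e ℕ.≟ m
... | yes refl = refl
... | no  e≢m  rewrite δ-≢ e m e≢m | ℚ.*-zeroʳ c | select-0ℚ (f m) | select-0ℚ (f e) = refl

coeffₛ-mask-∷ : ∀ b bs c e ts m →
                coeffₛ (mask (b ∷ bs) ((c , e) ∷ ts)) m ≡ select b (c *ℚ δ e m) +ℚ coeffₛ (mask bs ts) m
coeffₛ-mask-∷ true  bs c e ts m = refl
coeffₛ-mask-∷ false bs c e ts m = sym (ℚ.+-identityˡ _)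

coeffₛ-restrictₛ : ∀ f ts m → coeffₛ (restrictₛ f ts) m ≡ select (f m) (coeffₛ ts m)
coeffₛ-restrictₛ f []             m = sym (select-0ℚ (f m))
coeffₛ-restrictₛ f ((c , e) ∷ ts) m = begin
  coeffₛ (restrictₛ f ((c , e) ∷ ts)) m
    ≡⟨ coeffₛ-mask-∷ (f e) _ c e ts m ⟩
  select (f e) (c *ℚ δ e m) +ℚ coeffₛ (restrictₛ f ts) m
    ≡⟨ cong₂ _+ℚ_ (sym (select-δ f c e m)) (coeffₛ-restrictₛ f ts m) ⟩
  select (f m) (c *ℚ δ e m) +ℚ select (f m) (coeffₛ ts m)
    ≡⟨ select-+ (f m) _ _ ⟩
  select (f m) (c *ℚ δ e m +ℚ coeffₛ ts m) ∎
  where open ≡-Reasoning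

-- A record rather than w ∣ₚ ⟦ ts ⟧ itself, so that w and ts can be inferred from it.
infix 4 _∣ₛ_
record _∣ₛ_ (w : Poly) (ts : Sparse) : Set where
  constructor from-∣ₚ
  field to-∣ₚ : w ∣ₚ ⟦ ts ⟧
open _∣ₛ_

module _ {w : Poly} where

  ∣ₚ⇒∣ₛ : ∀ p ts → (∀ m → coeff p m ≡ coeffₛ ts m) → w ∣ₚ p → w ∣ₛ ts
  ∣ₚ⇒∣ₛ p ts p≈ts d = from-∣ₚ (∣ₚ-resp-≈ₚ w p ⟦ ts ⟧ (λ m → trans (p≈ts m) (sym (coeff-⟦⟧ ts m))) d)

  ∣ₛ-resp-≈ₛ : ∀ {ts us} → ts ≈ₛ us → w ∣ₛ ts → w ∣ₛ us
  ∣ₛ-resp-≈ₛ {ts} {us} ts≈us (from-∣ₚ d) = ∣ₚ⇒∣ₛ ⟦ ts ⟧ us (λ m → trans (coeff-⟦⟧ ts m) (ts≈us m)) d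

  ∣ₛ-++ : ∀ {ts us} → w ∣ₛ ts → w ∣ₛ us → w ∣ₛ (ts ++ us)
  ∣ₛ-++ {ts} {us} (from-∣ₚ d) (from-∣ₚ d′) = ∣ₚ⇒∣ₛ (⟦ ts ⟧ +ₚ ⟦ us ⟧) (ts ++ us) coeffs (∣ₚ-+ₚ w ⟦ ts ⟧ ⟦ us ⟧ d d′)
    where
    coeffs : ∀ m → coeff (⟦ ts ⟧ +ₚ ⟦ us ⟧) m ≡ coeffₛ (ts ++ us) m
    coeffs m = trans (coeff-+ₚ ⟦ ts ⟧ ⟦ us ⟧ m)
                     (trans (cong₂ _+ℚ_ (coeff-⟦⟧ ts m) (coeff-⟦⟧ us m)) (sym (coeffₛ-++ ts us m)))

  ∣ₛ-scaleₛ : ∀ {ts} k → w ∣ₛ ts → w ∣ₛ scaleₛ k ts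
  ∣ₛ-scaleₛ {ts} k (from-∣ₚ d) = ∣ₚ⇒∣ₛ (k ·ₚ ⟦ ts ⟧) (scaleₛ k ts) coeffs (∣ₚ-·ₚ w k ⟦ ts ⟧ d)
    where
    coeffs : ∀ m → coeff (k ·ₚ ⟦ ts ⟧) m ≡ coeffₛ (scaleₛ k ts) m
    coeffs m = trans (coeff-·ₚ k ⟦ ts ⟧ m) (trans (cong (k *ℚ_) (coeff-⟦⟧ ts m)) (sym (coeffₛ-scaleₛ k ts m)))

  ∣ₛ-shiftₛ : ∀ {ts} k → w ∣ₛ ts → w ∣ₛ shiftₛ k ts
  ∣ₛ-shiftₛ {ts} zero    d = subst (w ∣ₛ_) (sym (map-id ts)) d
  ∣ₛ-shiftₛ {ts} (suc k) d =
    ∣ₚ⇒∣ₛ (0ℚ ∷ ⟦ shiftₛ k ts ⟧) (shiftₛ (suc k) ts) coeffs (∣ₚ-∷0 w ⟦ shiftₛ k ts ⟧ (to-∣ₚ (∣ₛ-shiftₛ k d)))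
    where
    coeffs : ∀ m → coeff (0ℚ ∷ ⟦ shiftₛ k ts ⟧) m ≡ coeffₛ (shiftₛ (suc k) ts) m
    coeffs zero    = sym (coeffₛ-shiftₛ-zero k ts)
    coeffs (suc m) = trans (coeff-⟦⟧ (shiftₛ k ts) m) (sym (coeffₛ-shiftₛ-suc k ts m))

  ∣ₛ-restrictₛ : ∀ {ts} (f : ℕ → Bool) → (∀ i → coeff w i ≢ 0ℚ → ∀ j → f (i + j) ≡ f j) →
                 w ∣ₛ ts → w ∣ₛ restrictₛ f ts
  ∣ₛ-restrictₛ {ts} f inv (from-∣ₚ d) =
    ∣ₚ⇒∣ₛ (restrictₚ f ⟦ ts ⟧) (restrictₛ f ts) coeffs (∣ₚ-restrictₚ w ⟦ ts ⟧ f inv d)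
    where
    coeffs : ∀ m → coeff (restrictₚ f ⟦ ts ⟧) m ≡ coeffₛ (restrictₛ f ts) m
    coeffs m = trans (coeff-restrictₚ f ⟦ ts ⟧ m)
                     (trans (cong (select (f m)) (coeff-⟦⟧ ts m)) (sym (coeffₛ-restrictₛ f ts m)))

  ∤ₛ-single : ∀ {c e} → AtLeastTwoTerms w → c ≢ 0ℚ → ¬ (w ∣ₛ ((c , e) ∷ []))
  ∤ₛ-single {c} {e} two c≢0 (from-∣ₚ d) = ∤-mono w c e two c≢0 (subst (w ∣ₚ_) (+ₚ-identityʳ (mono c e)) d)

cancel-x^[a+e] : ∀ σ p q r →
  1ℚ *ℚ p +ℚ (σ *ℚ q +ℚ (σ *ℚ r +ℚ ((- σ *ℚ 1ℚ) *ℚ q +ℚ ((- σ *ℚ 1ℚ) *ℚ r +ℚ 0ℚ)))) ≡ 1ℚ *ℚ p +ℚ 0ℚ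
cancel-x^[a+e] = solve-∀ ℚ-ring

cancel-2σ : ∀ σ p q r →
  σ *ℚ p +ℚ (σ *ℚ q +ℚ ((- σ *ℚ 1ℚ) *ℚ p +ℚ ((- σ *ℚ 1ℚ) *ℚ r +ℚ ((σ *ℚ 1ℚ) *ℚ r +ℚ ((σ *ℚ 1ℚ) *ℚ q +ℚ 0ℚ)))))
    ≡ (σ +ℚ σ) *ℚ q +ℚ 0ℚ
cancel-2σ = solve-∀ ℚ-ring

a+b+[2a+b]≡a+[2a+2b] : ∀ a b → a + b + (2 * a + b) ≡ a + (2 * a + 2 * b)
a+b+[2a+b]≡a+[2a+2b] = ℕ-Ring.solve-∀

a+b+a≡2a+b : ∀ a b → a + b + a ≡ 2 * a + b
a+b+a≡2a+b = ℕ-Ring.solve-∀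

x^[a+e]-combination : ∀ σ a b e →
  shiftₛ a ((1ℚ , e) ∷ (σ , 2 * b) ∷ (σ , 0) ∷ []) ++ scaleₛ (- σ) ((1ℚ , a + 2 * b) ∷ (1ℚ , a) ∷ [])
    ≈ₛ (1ℚ , a + e) ∷ []
x^[a+e]-combination σ a b e m rewrite ℕ.+-identityʳ a =
  cancel-x^[a+e] σ (δ (a + e) m) (δ (a + 2 * b) m) (δ a m)

2σx^[2b]-combination : ∀ σ a b → let C = (1ℚ , a) ∷ (1ℚ , b) ∷ [] in
  (σ , 2 * a) ∷ (σ , 2 * b) ∷ [] ++ scaleₛ (- σ) (shiftₛ a C) ++ scaleₛ σ (shiftₛ b C)
    ≈ₛ (σ +ℚ σ , 2 * b) ∷ []
2σx^[2b]-combination σ a b m rewrite ℕ.+-identityʳ a | ℕ.+-identityʳ b | ℕ.+-comm b a =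
  cancel-2σ σ (δ (a + a) m) (δ (b + b) m) (δ (a + b) m)

2σx^a-combination : ∀ σ a b → let C = (1ℚ , 2 * a + b) ∷ (1ℚ , a) ∷ [] in
  shiftₛ a ((σ , 2 * a + 2 * b) ∷ (σ , 0) ∷ []) ++ scaleₛ (- σ) (shiftₛ (a + b) C) ++ scaleₛ σ C
    ≈ₛ (σ +ℚ σ , a) ∷ []
2σx^a-combination σ a b m rewrite a+b+[2a+b]≡a+[2a+2b] a b | a+b+a≡2a+b a b | ℕ.+-identityʳ a =
  cancel-2σ σ _ _ _

module _ {w : Poly} {σ : ℚ} where

  ∣x^[a+e] : ∀ a b {e} → w ∣ₛ (1ℚ , e) ∷ (σ , 2 * b) ∷ (σ , 0) ∷ [] → w ∣ₛ (1ℚ , a + 2 * b) ∷ (1ℚ , a) ∷ [] →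
             w ∣ₛ (1ℚ , a + e) ∷ []
  ∣x^[a+e] a b {e} d₀ d₁ =
    ∣ₛ-resp-≈ₛ (x^[a+e]-combination σ a b e) (∣ₛ-++ (∣ₛ-shiftₛ a d₀) (∣ₛ-scaleₛ (- σ) d₁))

  ∣2σx^[2b] : ∀ a b → w ∣ₛ (σ , 2 * a) ∷ (σ , 2 * b) ∷ [] → w ∣ₛ (1ℚ , a) ∷ (1ℚ , b) ∷ [] →
              w ∣ₛ (σ +ℚ σ , 2 * b) ∷ []
  ∣2σx^[2b] a b d₂ d₁ = ∣ₛ-resp-≈ₛ (2σx^[2b]-combination σ a b)
    (∣ₛ-++ d₂ (∣ₛ-++ (∣ₛ-scaleₛ (- σ) (∣ₛ-shiftₛ a d₁)) (∣ₛ-scaleₛ σ (∣ₛ-shiftₛ b d₁))))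

  ∣2σx^a : ∀ a b → w ∣ₛ (σ , 2 * a + 2 * b) ∷ (σ , 0) ∷ [] → w ∣ₛ (1ℚ , 2 * a + b) ∷ (1ℚ , a) ∷ [] →
           w ∣ₛ (σ +ℚ σ , a) ∷ []
  ∣2σx^a a b d₀ d₁ = ∣ₛ-resp-≈ₛ (2σx^a-combination σ a b)
    (∣ₛ-++ (∣ₛ-shiftₛ a d₀) (∣ₛ-++ (∣ₛ-scaleₛ (- σ) (∣ₛ-shiftₛ (a + b) d₁)) (∣ₛ-scaleₛ σ d₁)))

%-cong-+ : ∀ n .{{_ : NonZero n}} x x′ y y′ → x % n ≡ x′ % n → y % n ≡ y′ % n → (x + y) % n ≡ (x′ + y′) % n
%-cong-+ n x x′ y y′ hx hy = begin
  (x + y) % n            ≡⟨ %-distribˡ-+ x y n ⟩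
  (x % n + y % n) % n    ≡⟨ cong₂ (λ u v → (u + v) % n) hx hy ⟩
  (x′ % n + y′ % n) % n  ≡⟨ %-distribˡ-+ x′ y′ n ⟨
  (x′ + y′) % n          ∎
  where open ≡-Reasoning

%-cong-* : ∀ n .{{_ : NonZero n}} x x′ y y′ → x % n ≡ x′ % n → y % n ≡ y′ % n → (x * y) % n ≡ (x′ * y′) % n
%-cong-* n x x′ y y′ hx hy = begin
  (x * y) % n                ≡⟨ %-distribˡ-* x y n ⟩
  (x % n * (y % n)) % n      ≡⟨ cong₂ (λ u v → (u * v) % n) hx hy ⟩
  (x′ % n * (y′ % n)) % n    ≡⟨ %-distribˡ-* x′ y′ n ⟨
  (x′ * y′) % n              ∎
  where open ≡-Reasoning

exponents : ℕ → ℕ → List ℕ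
exponents a b = 2 * a + b ∷ a + 2 * b ∷ a ∷ b ∷ 2 * a + 2 * b ∷ 2 * a ∷ 2 * b ∷ 0 ∷ []

-- ⟦ terms -1ℚ a b ⟧ and ⟦ terms 1ℚ a b ⟧ are Qab a b and Rab a b by definition.
terms : ℚ → ℕ → ℕ → Sparse
terms σ a b = zip (1ℚ ∷ 1ℚ ∷ 1ℚ ∷ 1ℚ ∷ σ ∷ σ ∷ σ ∷ σ ∷ []) (exponents a b)

terms-swap : ∀ σ a b → terms σ a b ≈ₛ terms σ b a
terms-swap σ a b m rewrite ℕ.+-comm (2 * b) a | ℕ.+-comm b (2 * a) | ℕ.+-comm (2 * b) (2 * a) =
  swap σ (δ (2 * a + b) m) (δ (a + 2 * b) m) (δ a m) (δ b m) (δ (2 * a + 2 * b) m) (δ (2 * a) m) (δ (2 * b) m) (δ 0 m)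
  where
  swap : ∀ σ p q r s t u v x →
    1ℚ *ℚ p +ℚ (1ℚ *ℚ q +ℚ (1ℚ *ℚ r +ℚ (1ℚ *ℚ s +ℚ (σ *ℚ t +ℚ (σ *ℚ u +ℚ (σ *ℚ v +ℚ (σ *ℚ x +ℚ 0ℚ))))))) ≡
    1ℚ *ℚ q +ℚ (1ℚ *ℚ p +ℚ (1ℚ *ℚ s +ℚ (1ℚ *ℚ r +ℚ (σ *ℚ t +ℚ (σ *ℚ v +ℚ (σ *ℚ u +ℚ (σ *ℚ x +ℚ 0ℚ)))))))
  swap = solve-∀ ℚ-ring

exponents-% : ∀ a a′ b b′ → a % 4 ≡ a′ % 4 → b % 4 ≡ b′ % 4 →
              map (_% 4) (exponents a b) ≡ map (_% 4) (exponents a′ b′)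
exponents-% a a′ b b′ ha hb = Pointwise-≡⇒≡ (map⁺ (_% 4) (_% 4) pointwise)
  where
  2a = %-cong-* 4 2 2 a a′ refl ha
  2b = %-cong-* 4 2 2 b b′ refl hb
  pointwise : Pointwise (λ x y → x % 4 ≡ y % 4) (exponents a b) (exponents a′ b′)
  pointwise = %-cong-+ 4 (2 * a) (2 * a′) b b′ 2a hb
            ∷ %-cong-+ 4 a a′ (2 * b) (2 * b′) ha 2b
            ∷ ha
            ∷ hb
            ∷ %-cong-+ 4 (2 * a) (2 * a′) (2 * b) (2 * b′) 2a 2b
            ∷ 2a
            ∷ 2b
            ∷ refl
            ∷ []

inClass : ℕ → ℕ → Bool
inClass k m = m % 4 ≡ᵇ k

inClass-+ : ∀ w → ExponentsDivBy4 w → ∀ k i → coeff w i ≢ 0ℚ → ∀ j → inClass k (i + j) ≡ inClass k j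
inClass-+ w div4 k i wᵢ≢0 j = cong (_≡ᵇ k) (%-remove-+ˡ j (div4 i wᵢ≢0))

module _ {w : Poly} (two : AtLeastTwoTerms w) (div4 : ExponentsDivBy4 w) {σ : ℚ} (σ+σ≢0 : σ +ℚ σ ≢ 0ℚ) where

  -- The part depends on a and b only through the booleans, so for numerals a′ and b′ it normalises
  -- to the explicit list of terms of P_σ whose exponents lie in the class k.
  classPart : ∀ {a b a′ b′} k → a % 4 ≡ a′ → b % 4 ≡ b′ → w ∣ₛ terms σ a b →
              w ∣ₛ mask (map (inClass k) (exponents a′ b′)) (terms σ a b)
  classPart {a} {b} {a′} {b′} k ha hb d =
    subst (λ bs → w ∣ₛ mask bs (terms σ a b))
          (cong (map (_≡ᵇ k)) (exponents-% a a′ b b′ (≡-%4 a ha) (≡-%4 b hb)))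
          (∣ₛ-restrictₛ (inClass k) (inClass-+ w div4 k) d)
    where
    ≡-%4 : ∀ x {r} → x % 4 ≡ r → x % 4 ≡ r % 4
    ≡-%4 x h = trans (sym (m%n%n≡m%n x 4)) (cong (_% 4) h)

  ∣terms⇒2∣a : ∀ a b → w ∣ₛ terms σ a b → 2 ∣ a
  ∣terms⇒2∣a a b d = go (a % 4) (b % 4) refl refl (m%n<n a 4) (m%n<n b 4)
    where
    even : ∀ {r} → a % 4 ≡ r → 2 ∣ r → 2 ∣ a
    even ha 2∣r = ∣n∣m%n⇒∣m (divides 2 refl) (subst (2 ∣_) (sym ha) 2∣r)

    part : ∀ {r s} k → a % 4 ≡ r → b % 4 ≡ s → w ∣ₛ mask (map (inClass k) (exponents r s)) (terms σ a b)
    part k ha hb = classPart k ha hb d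

    ∤1 : ∀ {e} → ¬ (w ∣ₛ (1ℚ , e) ∷ [])
    ∤1 = ∤ₛ-single two (λ ())

    ∤2σ : ∀ {e} → ¬ (w ∣ₛ (σ +ℚ σ , e) ∷ [])
    ∤2σ = ∤ₛ-single two σ+σ≢0

    go : ∀ r s → a % 4 ≡ r → b % 4 ≡ s → r < 4 → s < 4 → 2 ∣ a
    go 0 _ ha _  _ _ = even ha (divides 0 refl)
    go 2 _ ha _  _ _ = even ha (divides 1 refl)
    go 1 0 ha hb _ _ = ⊥-elim (∤1  (∣x^[a+e]  a b (part 0 ha hb) (part 1 ha hb)))
    go 1 1 ha hb _ _ = ⊥-elim (∤2σ (∣2σx^[2b] a b (part 2 ha hb) (part 1 ha hb)))
    go 1 2 ha hb _ _ = ⊥-elim (∤1  (∣x^[a+e]  a b (part 0 ha hb) (part 1 ha hb)))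
    go 1 3 ha hb _ _ = ⊥-elim (∤2σ (∣2σx^a    a b (part 0 ha hb) (part 1 ha hb)))
    go 3 0 ha hb _ _ = ⊥-elim (∤1  (∣x^[a+e]  a b (part 0 ha hb) (part 3 ha hb)))
    go 3 1 ha hb _ _ = ⊥-elim (∤2σ (∣2σx^a    a b (part 0 ha hb) (part 3 ha hb)))
    go 3 2 ha hb _ _ = ⊥-elim (∤1  (∣x^[a+e]  a b (part 0 ha hb) (part 3 ha hb)))
    go 3 3 ha hb _ _ = ⊥-elim (∤2σ (∣2σx^[2b] a b (part 2 ha hb) (part 3 ha hb)))
    go (suc (suc (suc (suc _)))) _ _ _ (s≤s (s≤s (s≤s (s≤s ())))) _
    go _ (suc (suc (suc (suc _)))) _ _ _ (s≤s (s≤s (s≤s (s≤s ()))))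

  ∣terms⇒2∣a×2∣b : ∀ a b → w ∣ₛ terms σ a b → (2 ∣ a) × (2 ∣ b)
  ∣terms⇒2∣a×2∣b a b d = ∣terms⇒2∣a a b d , ∣terms⇒2∣a b a (∣ₛ-resp-≈ₛ (terms-swap σ a b) d)

lemma6p9 : (a b : ℕ) → a ≥ 1 → b ≥ 1 → (W : Poly) → AtLeastTwoTerms W → ExponentsDivBy4 W
    → (W ∣ₚ Qab a b) ⊎ (W ∣ₚ Rab a b) → (2 ∣ a) × (2 ∣ b)
lemma6p9 a b _ _ W two div4 (inj₁ W∣Q) = ∣terms⇒2∣a×2∣b {W} two div4 { -1ℚ } (λ ()) a b (from-∣ₚ W∣Q)
lemma6p9 a b _ _ W two div4 (inj₂ W∣R) = ∣terms⇒2∣a×2∣b {W} two div4 {1ℚ}   (λ ()) a b (from-∣ₚ W∣R)
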